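{- For every positive integer $r$ there exist $\delta=\delta(r)>0$ and $n_0=n_0(r)$ with the following property: if $A$ and $B$ are sets of real numbers with $|A|=|B|=n\ge n_0$ and $|A+B|\le n^{1+\delta}$, then any $r$-coloring of $A\times B$ contains a monochromatic corner, i.e. three points of the form $(a,b),(a+d,b),(a,b+d)$ with $d>0$. Moreover, one can choose $\delta=\frac{1}{2^{r+1}}$ (with a suitable $n_0(r)$).
   Context: $A+B=\{a+b: a\in A, b\in B\}$. -}

module Defs where

open import Level using (0ℓ)
open import Data.Nat using (ℕ)
open import Data.Product using (Σ; ∃; _×_)
open import Data.List using (List)
open import Data.List.Membership.Propositional using (_∈_)
open import Relation.Binary.PropositionalEquality using (_≡_)
open import Relation.Nullary using (¬_)
open import Algebra.Structures using (IsCommutativeRing)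
open import Relation.Binary.Structures using (IsStrictTotalOrder)

-- The real numbers, given axiomatically as a Dedekind-complete ordered field
-- (unique up to isomorphism).  The theorem is quantified over any such model.
record RealNumbers : Set₁ where
  infixl 6 _+_
  infixl 7 _*_
  infix 4 _<_
  field
    ℝ   : Set
    _+_ : ℝ → ℝ → ℝ
    _*_ : ℝ → ℝ → ℝ
    -_  : ℝ → ℝ
    0ℝ  : ℝ
    1ℝ  : ℝ
    _<_ : ℝ → ℝ → Set
    isCommutativeRing : IsCommutativeRing _≡_ _+_ _*_ -_ 0ℝ 1ℝ
    0≢1      : ¬ (0ℝ ≡ 1ℝ)
    inverse  : ∀ x → ¬ (x ≡ 0ℝ) → ∃ λ y → x * y ≡ 1ℝ
    isStrictTotalOrder : IsStrictTotalOrder _≡_ _<_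
    +-mono-< : ∀ {x y} z → x < y → x + z < y + z
    *-pos    : ∀ {x y} → 0ℝ < x → 0ℝ < y → 0ℝ < x * y
    sup : (P : ℝ → Set) → (∃ λ x → P x) → (∃ λ u → ∀ x → P x → ¬ (u < x)) →
          ∃ λ s → (∀ x → P x → ¬ (s < x)) × (∀ u → (∀ x → P x → ¬ (u < x)) → ¬ (u < s))

module _ (R : RealNumbers) where
  open RealNumbers R

  -- |A + B| ≤ m : the sumset A+B = {a+b} is covered by a list of at most m elements
  -- (equivalently, has at most m distinct elements).
  SumsetSizeAtMost : List ℝ → List ℝ → ℕ → Set
  SumsetSizeAtMost A B m =
    Σ (List ℝ) λ S → (Data.List.length S Data.Nat.≤ m) ×
      (∀ a b → a ∈ A → b ∈ B → (a + b) ∈ S)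
    where import Data.List; import Data.Nat

module Submission where

-- Let S ⊇ A + B with |S| ≤ m.  A *configuration* is a list X ⊆ A of
-- columns with a row of heights row(x) ⊆ B above each column, rows shrinking from
-- left to right, whose points all use colours from a palette L (or a corner has
-- already been found).  Label each point (x , y) by (x + y , colour) ∈ S × L.
-- By pigeonhole some label (s , z) is carried by ≥ N/(m|L|) points, at most one
-- per column; let X' be these columns.  The new configuration on X' with rows
-- {s - w : w ∈ X', w > x} has |X'| C 2 points, and each of its points of colour z
-- closes a corner (x , s - w), (w , s - w), (x , s - x); so z leaves the palette.
-- The invariant `Dense` (N ≥ K^(1/2^ℓ) m^(2 - 2^(1-ℓ)) for ℓ colours left) survives
-- this step, and when no colour is left any point gives a corner.

open import Defs
open import Data.Nat using (ℕ; suc; _≤_; _^_)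
open import Data.Fin using (Fin)
open import Data.Product using (Σ; ∃; _×_)
open import Data.List using (List; length)
open import Data.List.Membership.Propositional using (_∈_)
open import Data.List.Relation.Unary.Unique.Propositional using (Unique)
open import Relation.Binary.PropositionalEquality using (_≡_)

open import Level using (0ℓ)
open import Function using (_∘_; id)
open import Data.Nat using (zero; z≤n; s≤s)
open import Data.Nat.Properties using (≤-refl; ≤-reflexive; ≤-trans)
open import Data.Product using (_,_; proj₁; proj₂)
open import Data.Sum using (_⊎_; inj₁; inj₂)
open import Data.List using ([]; _∷_; _++_; map; filter; cartesianProduct)
open import Data.Nat.ListAction using (sum)
open import Data.List.Properties using (length-++; length-map; filter-accept; filter-reject; filter-none)
open import Data.List.Relation.Unary.Any using (here; there)
open import Data.List.Relation.Unary.All as All using (All; []; _∷_)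
open import Data.List.Relation.Unary.Unique.Propositional using ([]; _∷_)
open import Relation.Binary.Core using (Rel)
open import Relation.Binary.Definitions using (DecidableEquality; Tri; tri<; tri≈; tri>)
open import Relation.Binary.Structures using (IsStrictTotalOrder)
open import Algebra.Structures using (IsCommutativeRing)
open import Relation.Binary.PropositionalEquality using (refl; sym; trans; cong; cong₂; subst; _≢_; module ≡-Reasoning)
open import Relation.Nullary using (Dec; yes; no; ¬_; contradiction)
open import Relation.Unary using (Decidable)

module ListFacts where
  open import Data.Nat using (_+_; _*_)
  open import Data.Nat.Properties using (<⇒≤; ≰⇒>; _≤?_; +-mono-≤; +-monoʳ-≤; *-monoˡ-≤; +-identityʳ; *-identityʳ; *-suc)

  first-failure : ∀ {I : Set} {P : I → Set} {C : Set} (is : List I) →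
                  (∀ {i} → i ∈ is → P i ⊎ C) → C ⊎ (∀ {i} → i ∈ is → P i)
  first-failure [] h = inj₂ λ ()
  first-failure (i ∷ is) h with h (here refl) | first-failure is (h ∘ there)
  ... | inj₂ witness | _           = inj₁ witness
  ... | inj₁ _       | inj₁ witness = inj₁ witness
  ... | inj₁ Pi      | inj₂ Pis    = inj₂ λ { (here refl) → Pi ; (there i∈) → Pis i∈ }

  some-element : ∀ {I : Set} (is : List I) → 1 ≤ length is → ∃ λ i → i ∈ is
  some-element (i ∷ _) _ = i , here refl

  member⇒nonempty : ∀ {I : Set} {i : I} {is : List I} → i ∈ is → 1 ≤ length is
  member⇒nonempty {is = _ ∷ _} _ = s≤s z≤n

  no-element : ∀ {I : Set} {i : I} {is : List I} → length is ≤ 0 → ¬ (i ∈ is)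
  no-element {is = _ ∷ _} () _

  filter-at-most-one : ∀ {I : Set} {P : I → Set} (P? : Decidable P) {is : List I} → Unique is →
                       (∀ {i j} → i ∈ is → j ∈ is → P i → P j → i ≡ j) →
                       length (filter P? is) ≤ 1
  filter-at-most-one P? [] _ = z≤n
  filter-at-most-one P? {i ∷ is} (i∉is ∷ u) single with P? i
  ... | yes Pi = s≤s (≤-reflexive (cong length (filter-none P? (All.tabulate others-fail))))
    where
    others-fail : ∀ {j} → j ∈ is → ¬ _
    others-fail j∈ Pj = All.lookup i∉is j∈ (single (here refl) (there j∈) Pi Pj)
  ... | no _ = filter-at-most-one P? u (λ i∈ j∈ → single (there i∈) (there j∈))

  length-cartesianProduct : ∀ {I J : Set} (is : List I) (js : List J) →
                            length (cartesianProduct is js) ≡ length is * length js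
  length-cartesianProduct [] js = refl
  length-cartesianProduct (i ∷ is) js = begin
    length (map (i ,_) js ++ cartesianProduct is js)      ≡⟨ length-++ (map (i ,_) js) ⟩
    length (map (i ,_) js) + length (cartesianProduct is js) ≡⟨ cong₂ _+_ (length-map (i ,_) js) (length-cartesianProduct is js) ⟩
    length js + length is * length js ∎
    where open ≡-Reasoning

  sum≤max*length : ∀ {J : Set} (g : J → ℕ) (Bs : List J) {b₀ : J} → b₀ ∈ Bs →
                   ∃ λ b → b ∈ Bs × sum (map g Bs) ≤ g b * length Bs
  sum≤max*length g (b ∷ []) _ = b , here refl , ≤-reflexive (trans (+-identityʳ (g b)) (sym (*-identityʳ (g b))))
  sum≤max*length g (b ∷ Bs@(_ ∷ _)) _ with sum≤max*length g Bs (here refl)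
  ... | b₁ , b₁∈ , rest≤ with g b ≤? g b₁
  ...   | yes gb≤ = b₁ , there b₁∈ , ≤-trans (+-mono-≤ gb≤ rest≤) (≤-reflexive (sym (*-suc (g b₁) _)))
  ...   | no gb≰ = b , here refl , ≤-trans (+-monoʳ-≤ (g b) (≤-trans rest≤ (*-monoˡ-≤ _ (<⇒≤ (≰⇒> gb≰)))))
                                             (≤-reflexive (sym (*-suc (g b) _)))

module Pigeonhole {I J : Set} (_≟_ : DecidableEquality J) (f : I → J) where
  open import Data.Nat using (_*_; _<_)
  open import Data.Nat.Properties using (n≤1+n; +-mono-≤; +-suc)
  open ListFacts using (sum≤max*length)

  fibre : J → List I → List I
  fibre b = filter (λ i → f i ≟ b)

  fibreSize : J → List I → ℕ
  fibreSize b is = length (fibre b is)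

  fibre-grows : ∀ b i is → fibreSize b is ≤ fibreSize b (i ∷ is)
  fibre-grows b i is with f i ≟ b
  ... | yes _ = n≤1+n _
  ... | no _  = ≤-refl

  total : List J → List I → ℕ
  total Bs is = sum (map (λ b → fibreSize b is) Bs)

  total-grows : ∀ Bs i is → total Bs is ≤ total Bs (i ∷ is)
  total-grows [] i is = z≤n
  total-grows (b ∷ Bs) i is = +-mono-≤ (fibre-grows b i is) (total-grows Bs i is)

  total-hit : ∀ Bs i is → f i ∈ Bs → total Bs is < total Bs (i ∷ is)
  total-hit (b ∷ Bs) i is (here refl) =
    +-mono-≤ (≤-reflexive (sym (cong length (filter-accept (λ j → f j ≟ b) refl)))) (total-grows Bs i is)
  total-hit (b ∷ Bs) i is (there fi∈) =
    ≤-trans (≤-reflexive (sym (+-suc _ _))) (+-mono-≤ (fibre-grows b i is) (total-hit Bs i is fi∈))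

  length≤total : ∀ Bs is → (∀ {i} → i ∈ is → f i ∈ Bs) → length is ≤ total Bs is
  length≤total Bs [] _ = z≤n
  length≤total Bs (i ∷ is) labelled =
    ≤-trans (s≤s (length≤total Bs is (labelled ∘ there))) (total-hit Bs i is (labelled (here refl)))

  pigeonhole : ∀ Bs is {i₀} → i₀ ∈ is → (∀ {i} → i ∈ is → f i ∈ Bs) →
               ∃ λ b → b ∈ Bs × length is ≤ fibreSize b is * length Bs
  pigeonhole Bs is i₀∈ labelled with sum≤max*length (λ b → fibreSize b is) Bs (labelled i₀∈)
  ... | b , b∈ , total≤ = b , b∈ , ≤-trans (length≤total Bs is labelled) total≤

module Choose2 where
  open import Data.Nat using (_+_; _*_)
  open import Data.Nat.Properties using (+-mono-≤; m≤m+n; module ≤-Reasoning)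
  open import Data.Nat.Combinatorics using (_C_; nC1≡n; nCk+nC[k+1]≡[n+1]C[k+1])
  open import Data.Nat.Tactic.RingSolver using (solve-∀)

  -- Pascal's rule for k = 2: a new element forms a pair with each of the k old ones.
  suc-C2 : ∀ k → suc k C 2 ≡ k + k C 2
  suc-C2 k = trans (sym (nCk+nC[k+1]≡[n+1]C[k+1] k 1)) (cong (_+ k C 2) (nC1≡n k))

  square≤4·C2 : ∀ k → 2 ≤ k → k * k ≤ 4 * (k C 2)
  square≤4·C2 (suc zero)            (s≤s ())
  square≤4·C2 (suc (suc zero))      _ = ≤-refl
  square≤4·C2 (suc k@(suc (suc j))) _ = begin
    suc k * suc k                              ≡⟨ expand k ⟩
    k * k + (k + k + 1)                        ≤⟨ +-mono-≤ (square≤4·C2 k (s≤s (s≤s z≤n))) (m≤m+n (k + k + 1) (2 * j + 3)) ⟩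
    4 * (k C 2) + (k + k + 1 + (2 * j + 3))    ≡⟨ regroup j (k C 2) ⟩
    4 * (k + k C 2)                            ≡⟨ cong (4 *_) (suc-C2 k) ⟨
    4 * (suc k C 2)                            ∎
    where
    open ≤-Reasoning
    expand : ∀ k → suc k * suc k ≡ k * k + (k + k + 1)
    expand = solve-∀
    regroup : ∀ j t → 4 * t + (suc (suc j) + suc (suc j) + 1 + (2 * j + 3)) ≡ 4 * (suc (suc j) + t)
    regroup = solve-∀

module OrderedPairs {A : Set} {_<_ : Rel A 0ℓ} (sto : IsStrictTotalOrder _≡_ _<_) where
  open IsStrictTotalOrder sto using (_<?_; compare; irrefl)
  open import Data.Nat using (_+_)
  open import Data.Nat.Properties using (+-suc; +-assoc; +-commutativeSemigroup)
  open import Data.Nat.Combinatorics using (_C_)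
  open import Algebra.Properties.CommutativeSemigroup +-commutativeSemigroup using () renaming (x∙yz≈y∙xz to exchange)
  open Choose2 using (suc-C2)
  open ≡-Reasoning

  above : A → List A → List A
  above x = filter (x <?_)

  below : A → List A → List A
  below x = filter (_<? x)

  pairsAbove : List A → List A → ℕ
  pairsAbove Z X = sum (map (λ x → length (above x Z)) X)

  above+below : ∀ y Y → All (y ≢_) Y → length (above y Y) + length (below y Y) ≡ length Y
  above+below y [] [] = refl
  above+below y (w ∷ Y) (y≢w ∷ y∉Y) = by-comparison (compare y w)
    where
    by-comparison : Tri (y < w) (y ≡ w) (w < y) →
                    length (above y (w ∷ Y)) + length (below y (w ∷ Y)) ≡ suc (length Y)
    by-comparison (tri< y<w _ w≮y) = begin
      length (above y (w ∷ Y)) + length (below y (w ∷ Y))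
        ≡⟨ cong₂ (λ a b → length a + length b) (filter-accept (y <?_) y<w) (filter-reject (_<? y) w≮y) ⟩
      suc (length (above y Y) + length (below y Y))
        ≡⟨ cong suc (above+below y Y y∉Y) ⟩
      suc (length Y) ∎
    by-comparison (tri≈ _ y≡w _) = contradiction y≡w y≢w
    by-comparison (tri> y≮w _ w<y) = begin
      length (above y (w ∷ Y)) + length (below y (w ∷ Y))
        ≡⟨ cong₂ (λ a b → length a + length b) (filter-reject (y <?_) y≮w) (filter-accept (_<? y) w<y) ⟩
      length (above y Y) + suc (length (below y Y))
        ≡⟨ +-suc _ _ ⟩
      suc (length (above y Y) + length (below y Y))
        ≡⟨ cong suc (above+below y Y y∉Y) ⟩
      suc (length Y) ∎

  pairsAbove-cons : ∀ y Y X → pairsAbove (y ∷ Y) X ≡ length (below y X) + pairsAbove Y X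
  pairsAbove-cons y Y [] = refl
  pairsAbove-cons y Y (x ∷ X) = by-decision (x <? y)
    where
    a = length (above x Y)
    b = length (below y X)
    p = pairsAbove Y X
    by-decision : Dec (x < y) → length (above x (y ∷ Y)) + pairsAbove (y ∷ Y) X ≡ length (below y (x ∷ X)) + (a + p)
    by-decision (yes x<y) = begin
      length (above x (y ∷ Y)) + pairsAbove (y ∷ Y) X
        ≡⟨ cong₂ (λ l q → length l + q) (filter-accept (x <?_) x<y) (pairsAbove-cons y Y X) ⟩
      suc (a + (b + p))   ≡⟨ cong suc (exchange a b p) ⟩
      suc (b + (a + p))   ≡⟨ cong (λ l → length l + (a + p)) (filter-accept (_<? y) x<y) ⟨
      length (below y (x ∷ X)) + (a + p) ∎
    by-decision (no x≮y) = begin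
      length (above x (y ∷ Y)) + pairsAbove (y ∷ Y) X
        ≡⟨ cong₂ (λ l q → length l + q) (filter-reject (x <?_) x≮y) (pairsAbove-cons y Y X) ⟩
      a + (b + p)         ≡⟨ exchange a b p ⟩
      b + (a + p)         ≡⟨ cong (λ l → length l + (a + p)) (filter-reject (_<? y) x≮y) ⟨
      length (below y (x ∷ X)) + (a + p) ∎

  pairsAbove-self : ∀ X → Unique X → pairsAbove X X ≡ length X C 2
  pairsAbove-self [] [] = refl
  pairsAbove-self (y ∷ Y) (y∉Y ∷ u) = begin
    length (above y (y ∷ Y)) + pairsAbove (y ∷ Y) Y
      ≡⟨ cong₂ (λ a p → length a + p) (filter-reject (y <?_) (irrefl refl)) (pairsAbove-cons y Y Y) ⟩
    length (above y Y) + (length (below y Y) + pairsAbove Y Y)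
      ≡⟨ sym (+-assoc (length (above y Y)) _ _) ⟩
    (length (above y Y) + length (below y Y)) + pairsAbove Y Y
      ≡⟨ cong₂ _+_ (above+below y Y y∉Y) (pairsAbove-self Y u) ⟩
    length Y + length Y C 2
      ≡⟨ suc-C2 (length Y) ⟨
    suc (length Y) C 2 ∎

module Density where
  open import Data.Nat using (_+_; _*_; _<_; _∸_; NonZero; >-nonZero)
  open import Data.Nat.Properties using
    (*-assoc; *-comm; *-mono-≤; *-monoʳ-≤; *-monoˡ-≤; *-cancelˡ-≤; *-monoˡ-<; m≤n*m; m≤m+n; m+[n∸m]≡n;
     ^-distribˡ-+-*; ^-*-assoc; ^-monoˡ-≤; ^-monoʳ-≤; ^-monoˡ-<; ^-monoʳ-<; ^-zeroˡ; m^n≢0; m^n>0;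
     ≮⇒≥; <⇒≱; ≤-pred; ≰⇒>; _≤?_; +-mono-≤; +-identityʳ; *-identityˡ; *-identityʳ; module ≤-Reasoning)
  open import Data.Nat.Tactic.RingSolver using (solve-∀)
  open import Data.Nat.Combinatorics using (_C_)
  open Choose2 using (square≤4·C2)

  ^-distribʳ-* : ∀ a b e → (a * b) ^ e ≡ a ^ e * b ^ e
  ^-distribʳ-* a b zero    = refl
  ^-distribʳ-* a b (suc e) = trans (cong ((a * b) *_) (^-distribʳ-* a b e)) (swap a b (a ^ e) (b ^ e))
    where
    swap : ∀ a b x y → (a * b) * (x * y) ≡ (a * x) * (b * y)
    swap = solve-∀

  ^-double : ∀ a e → a ^ (2 * e) ≡ a ^ e * a ^ e
  ^-double a e = trans (cong (a ^_) (cong (e +_) (+-identityʳ e))) (^-distribˡ-+-* a e e)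

  ^-square : ∀ a e → (a * a) ^ e ≡ a ^ (2 * e)
  ^-square a e = trans (^-distribʳ-* a a e) (sym (^-double a e))

  ^-cancelʳ-≤ : ∀ e .{{_ : NonZero e}} {a b} → a ^ e ≤ b ^ e → a ≤ b
  ^-cancelʳ-≤ e aᵉ≤bᵉ = ≮⇒≥ λ b<a → <⇒≱ (^-monoˡ-< e b<a) aᵉ≤bᵉ

  2^-pos : ∀ ℓ → 1 ≤ 2 ^ ℓ
  2^-pos ℓ = m^n>0 2 ℓ

  -- The constant lost in ℓ rounds of colour elimination.
  K : ℕ → ℕ
  K zero    = 1
  K (suc ℓ) = 4 ^ (2 ^ ℓ) * (suc ℓ ^ (2 ^ suc ℓ) * K ℓ)

  K-pos : ∀ ℓ → 1 ≤ K ℓ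
  K-pos zero    = ≤-refl
  K-pos (suc ℓ) = *-mono-≤ (m^n>0 4 (2 ^ ℓ)) (*-mono-≤ (m^n>0 (suc ℓ) (2 ^ suc ℓ)) (K-pos ℓ))

  -- N points are dense for ℓ remaining colours and label bound m when
  -- N ≥ (K ℓ)^(1/2^ℓ) · m^(2 - 2^(1-ℓ)), written without roots or division.
  Dense : ℕ → ℕ → ℕ → Set
  Dense ℓ m N = K ℓ * m ^ (2 ^ suc ℓ) ≤ N ^ (2 ^ ℓ) * (m * m)

  dense⇒nonempty : ∀ {ℓ m N} → 1 ≤ m → Dense ℓ m N → 1 ≤ N
  dense⇒nonempty {ℓ} {m} {zero} m≥1 dense =
    contradiction (subst (λ t → K ℓ * m ^ (2 ^ suc ℓ) ≤ t * (m * m)) (zero^ (2^-pos ℓ)) dense)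
                  (<⇒≱ (*-mono-≤ (K-pos ℓ) (m^n>0 m {{>-nonZero m≥1}} (2 ^ suc ℓ))))
    where
    zero^ : ∀ {e} → 1 ≤ e → 0 ^ e ≡ 0
    zero^ {suc _} _ = refl
  dense⇒nonempty {N = suc _} _ _ = s≤s z≤n

  -- If N points are dense for ℓ+1 colours and N ≤ k·m·(ℓ+1) (a class found by
  -- pigeonhole among m·(ℓ+1) labels has size ≤ k), then k² is at least
  -- 4 (K ℓ)^(1/2^ℓ) m^(2 - 2^(1-ℓ)); the factors (ℓ+1) and m cancel against K (ℓ+1).
  dense-reduce : ∀ {ℓ m N k} → 1 ≤ m → Dense (suc ℓ) m N → N ≤ k * (m * suc ℓ) →
                 4 ^ (2 ^ ℓ) * (K ℓ * m ^ (2 ^ suc ℓ)) ≤ (k * k) ^ (2 ^ ℓ) * (m * m)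
  dense-reduce {ℓ} {m} {N} {k} m≥1 dense N≤ = *-cancelˡ-≤ (σ * μ) {{common≢0}} (begin
    (σ * μ) * (4 ^ p * (K ℓ * μ))     ≡⟨ regroup σ μ (4 ^ p) (K ℓ) ⟩
    K (suc ℓ) * (μ * μ)               ≡⟨ cong (K (suc ℓ) *_) (^-double m q) ⟨
    K (suc ℓ) * m ^ (2 * q)           ≤⟨ dense ⟩
    N ^ q * (m * m)                   ≤⟨ *-monoˡ-≤ (m * m) (^-monoˡ-≤ q N≤) ⟩
    (k * (m * suc ℓ)) ^ q * (m * m)   ≡⟨ cong (_* (m * m)) split ⟩
    (k ^ q * (μ * σ)) * (m * m)       ≡⟨ collect σ μ (k ^ q) (m * m) ⟩
    (σ * μ) * (k ^ q * (m * m))       ≡⟨ cong (λ t → (σ * μ) * (t * (m * m))) (^-square k p) ⟨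
    (σ * μ) * ((k * k) ^ p * (m * m)) ∎)
    where
    open ≤-Reasoning
    p = 2 ^ ℓ
    q = 2 ^ suc ℓ
    σ = suc ℓ ^ q
    μ = m ^ q
    common≢0 : NonZero (σ * μ)
    common≢0 = >-nonZero (*-mono-≤ (m^n>0 (suc ℓ) q) (m^n>0 m {{>-nonZero m≥1}} q))
    split : (k * (m * suc ℓ)) ^ q ≡ k ^ q * (μ * σ)
    split = trans (^-distribʳ-* k (m * suc ℓ) q) (cong (k ^ q *_) (^-distribʳ-* m (suc ℓ) q))
    regroup : ∀ σ μ c κ → (σ * μ) * (c * (κ * μ)) ≡ (c * (σ * κ)) * (μ * μ)
    regroup = solve-∀
    collect : ∀ σ μ x y → (x * (μ * σ)) * y ≡ (σ * μ) * (x * y)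
    collect = solve-∀

  dense-reduce-contradiction : ∀ {ℓ m k} → 1 ≤ m → k ≤ 1 →
    (k * k) ^ (2 ^ ℓ) * (m * m) < 4 ^ (2 ^ ℓ) * (K ℓ * m ^ (2 ^ suc ℓ))
  dense-reduce-contradiction {ℓ} {m} {k} m≥1 k≤1 = begin-strict
    (k * k) ^ p * (m * m)  ≤⟨ *-monoˡ-≤ (m * m) (≤-trans (^-monoˡ-≤ p (*-mono-≤ k≤1 k≤1)) (≤-reflexive (^-zeroˡ p))) ⟩
    1 * (m * m)            ≡⟨ trans (*-identityˡ (m * m)) (cong (m *_) (sym (*-identityʳ m))) ⟩
    m ^ 2                  ≤⟨ ^-monoʳ-≤ m {{>-nonZero m≥1}} (*-monoʳ-≤ 2 (2^-pos ℓ)) ⟩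
    m ^ q                  ≤⟨ m≤n*m (m ^ q) (K ℓ) {{>-nonZero (K-pos ℓ)}} ⟩
    K ℓ * m ^ q            ≡⟨ *-identityˡ (K ℓ * m ^ q) ⟨
    1 * (K ℓ * m ^ q)      <⟨ *-monoˡ-< (K ℓ * m ^ q) {{>-nonZero (*-mono-≤ (K-pos ℓ) (m^n>0 m {{>-nonZero m≥1}} q))}}
                                (^-monoʳ-< 4 (s≤s (s≤s z≤n)) (2^-pos ℓ)) ⟩
    4 ^ p * (K ℓ * m ^ q)  ∎
    where
    open ≤-Reasoning
    p = 2 ^ ℓ
    q = 2 ^ suc ℓ

  -- The density increment: k columns as above span k C 2 ≥ k²/4 points, which are
  -- dense for one colour fewer.
  dense-step : ∀ {ℓ m N} k → 1 ≤ m → Dense (suc ℓ) m N → N ≤ k * (m * suc ℓ) → Dense ℓ m (k C 2)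
  dense-step {ℓ} {m} {N} k m≥1 dense N≤ with 2 ≤? k
  ... | yes k≥2 = *-cancelˡ-≤ (4 ^ p) {{m^n≢0 4 p}} (begin
    4 ^ p * (K ℓ * m ^ (2 ^ suc ℓ))  ≤⟨ dense-reduce {ℓ} {m} {N} {k} m≥1 dense N≤ ⟩
    (k * k) ^ p * (m * m)            ≤⟨ *-monoˡ-≤ (m * m) (^-monoˡ-≤ p (square≤4·C2 k k≥2)) ⟩
    (4 * (k C 2)) ^ p * (m * m)      ≡⟨ cong (_* (m * m)) (^-distribʳ-* 4 (k C 2) p) ⟩
    4 ^ p * (k C 2) ^ p * (m * m)    ≡⟨ *-assoc (4 ^ p) ((k C 2) ^ p) (m * m) ⟩
    4 ^ p * ((k C 2) ^ p * (m * m))  ∎)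
    where
    open ≤-Reasoning
    p = 2 ^ ℓ
  ... | no k≱2 = contradiction (dense-reduce {ℓ} {m} {N} {k} m≥1 dense N≤)
                   (<⇒≱ (dense-reduce-contradiction {ℓ} m≥1 (≤-pred (≰⇒> k≱2))))

  -- If 1 ≤ κ ≤ n and m^E ≤ n^(E+1) for an exponent E ≥ 2, then κ m^E ≤ n^E m²:
  -- raising κ m^(E-2) to the E-th power gives at most n^(E + (E+1)(E-2)) ≤ (n^E)^E.
  root-bound : ∀ f {κ m n} → 1 ≤ κ → κ ≤ n → m ^ (2 + f) ≤ n ^ suc (2 + f) →
               κ * m ^ (2 + f) ≤ n ^ (2 + f) * (m * m)
  root-bound f {κ} {m} {n} κ≥1 κ≤n mᴱ≤ = begin
    κ * m ^ E           ≡⟨ regroup κ m (m ^ f) ⟩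
    κ * m ^ f * (m * m) ≤⟨ *-monoˡ-≤ (m * m) (^-cancelʳ-≤ E {κ * m ^ f} {n ^ E} powered) ⟩
    n ^ E * (m * m)     ∎
    where
    open ≤-Reasoning
    E = 2 + f
    regroup : ∀ κ m x → κ * (m * (m * x)) ≡ κ * x * (m * m)
    regroup = solve-∀
    exponent : ∀ f → (2 + f) * (2 + f) ≡ ((2 + f) + suc (2 + f) * f) + 2
    exponent = solve-∀
    exponent≤ : E + suc E * f ≤ E * E
    exponent≤ = ≤-trans (m≤m+n _ 2) (≤-reflexive (sym (exponent f)))
    swap-exponents : (m ^ f) ^ E ≡ (m ^ E) ^ f
    swap-exponents = trans (^-*-assoc m f E) (trans (cong (m ^_) (*-comm f E)) (sym (^-*-assoc m E f)))
    powered : (κ * m ^ f) ^ E ≤ (n ^ E) ^ E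
    powered = begin
      (κ * m ^ f) ^ E        ≡⟨ ^-distribʳ-* κ (m ^ f) E ⟩
      κ ^ E * (m ^ f) ^ E    ≡⟨ cong (κ ^ E *_) swap-exponents ⟩
      κ ^ E * (m ^ E) ^ f    ≤⟨ *-mono-≤ (^-monoˡ-≤ E κ≤n) (^-monoˡ-≤ f mᴱ≤) ⟩
      n ^ E * (n ^ suc E) ^ f ≡⟨ cong (n ^ E *_) (^-*-assoc n (suc E) f) ⟩
      n ^ E * n ^ (suc E * f) ≡⟨ ^-distribˡ-+-* n E (suc E * f) ⟨
      n ^ (E + suc E * f)    ≤⟨ ^-monoʳ-≤ n {{>-nonZero (≤-trans κ≥1 κ≤n)}} exponent≤ ⟩
      n ^ (E * E)            ≡⟨ ^-*-assoc n E E ⟨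
      (n ^ E) ^ E            ∎

  dense-initial : ∀ r {m n} → K r ≤ n → m ^ (2 ^ suc r) ≤ n ^ suc (2 ^ suc r) → Dense r m (n * n)
  dense-initial r {m} {n} K≤n mᵠ≤ =
    subst (λ t → K r * m ^ q ≤ t * (m * m)) (sym (^-square n (2 ^ r)))
      (subst (λ e → m ^ e ≤ n ^ suc e → K r * m ^ e ≤ n ^ e * (m * m)) q≡2+f
        (root-bound (q ∸ 2) {K r} {m} {n} (K-pos r) K≤n) mᵠ≤)
    where
    q = 2 ^ suc r
    q≡2+f : 2 + (q ∸ 2) ≡ q
    q≡2+f = m+[n∸m]≡n (*-monoʳ-≤ 2 (2^-pos r))

module Differences (R : RealNumbers) where
  open RealNumbers R
  open IsCommutativeRing isCommutativeRing using (+-assoc; +-comm; +-identityˡ; -‿inverseˡ; -‿inverseʳ)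
  open ≡-Reasoning

  infixl 6 _-_
  _-_ : ℝ → ℝ → ℝ
  x - y = x + - y

  +-diff : ∀ x y → x + (y - x) ≡ y
  +-diff x y = begin
    x + (y + - x)   ≡⟨ cong (x +_) (+-comm y (- x)) ⟩
    x + (- x + y)   ≡⟨ +-assoc x (- x) y ⟨
    (x + - x) + y   ≡⟨ cong (_+ y) (-‿inverseʳ x) ⟩
    0ℝ + y          ≡⟨ +-identityˡ y ⟩
    y               ∎

  diff-telescope : ∀ s x x' → (s - x') + (x' - x) ≡ s - x
  diff-telescope s x x' = begin
    (s + - x') + (x' + - x) ≡⟨ +-assoc s (- x') (x' + - x) ⟩
    s + (- x' + (x' + - x)) ≡⟨ cong (s +_) (+-assoc (- x') x' (- x)) ⟨
    s + ((- x' + x') + - x) ≡⟨ cong (λ t → s + (t + - x)) (-‿inverseˡ x') ⟩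
    s + (0ℝ + - x)          ≡⟨ cong (s +_) (+-identityˡ (- x)) ⟩
    s + - x                 ∎

  solve-for : ∀ x y s → x + y ≡ s → y ≡ s - x
  solve-for x y s x+y≡s = begin
    y               ≡⟨ +-identityˡ y ⟨
    0ℝ + y          ≡⟨ cong (_+ y) (-‿inverseˡ x) ⟨
    (- x + x) + y   ≡⟨ +-assoc (- x) x y ⟩
    - x + (x + y)   ≡⟨ cong (- x +_) x+y≡s ⟩
    - x + s         ≡⟨ +-comm (- x) s ⟩
    s - x           ∎

  diff-injective : ∀ s a b → s - a ≡ s - b → a ≡ b
  diff-injective s a b eq = begin
    a               ≡⟨ solve-for (s - a) a s (trans (+-comm (s - a) a) (+-diff a s)) ⟩
    s - (s - a)     ≡⟨ cong (λ t → s - t) eq ⟩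
    s - (s - b)     ≡⟨ solve-for (s - b) b s (trans (+-comm (s - b) b) (+-diff b s)) ⟨
    b               ∎

  diff-pos : ∀ {x x'} → x < x' → 0ℝ < x' - x
  diff-pos {x} {x'} x<x' = subst (_< x' - x) (-‿inverseʳ x) (+-mono-< (- x) x<x')

module CornerSearch (R : RealNumbers) {r : ℕ} (A B S : List (RealNumbers.ℝ R))
    (c : RealNumbers.ℝ R → RealNumbers.ℝ R → Fin r)
    (A+B⊆S : ∀ a b → a ∈ A → b ∈ B → RealNumbers._+_ R a b ∈ S) where
  import Data.Nat as ℕ
  open import Data.Nat using (_*_)
  open import Data.Nat.Properties using (*-mono-≤; +-mono-≤; ≤-pred; module ≤-Reasoning)
  open import Data.Nat.Combinatorics using (_C_)
  import Data.Fin as Fin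
  open import Data.List using (allFin)
  open import Data.List.Properties using (map-cong; filter-notAll; filter-++; length-tabulate)
  open import Data.List.Membership.Propositional.Properties
    using (∈-map⁺; ∈-map⁻; ∈-filter⁺; ∈-filter⁻; ∈-++⁻; ∈-cartesianProduct⁺; ∈-cartesianProduct⁻; ∈-allFin)
  import Data.List.Relation.Unary.Any as Any
  import Data.List.Relation.Unary.Unique.Propositional.Properties as Unique
  open import Data.Product.Properties using (≡-dec)
  open import Relation.Nullary.Decidable using (_×-dec_; ¬?)
  open RealNumbers R hiding (_*_)
  open IsStrictTotalOrder isStrictTotalOrder using (_≟_; _<?_) renaming (trans to <-trans)
  open import Data.List.Membership.DecPropositional _≟_ using (_∈?_)
  open Differences R
  open ListFacts using (first-failure; some-element; member⇒nonempty; no-element; filter-at-most-one; length-cartesianProduct)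
  open OrderedPairs isStrictTotalOrder using (above; pairsAbove-self)
  open Density using (K; K-pos; Dense; dense⇒nonempty; dense-step; dense-initial)

  Corner : Set
  Corner = Σ ℝ λ a → Σ ℝ λ b → Σ ℝ λ d →
    (0ℝ < d) × (a ∈ A) × ((a + d) ∈ A) × (b ∈ B) × ((b + d) ∈ B) ×
    (c (a + d) b ≡ c a b) × (c a (b + d) ≡ c a b)

  points : List ℝ → (ℝ → List ℝ) → List (ℝ × ℝ)
  points []      row = []
  points (x ∷ X) row = map (x ,_) (row x) ++ points X row

  size : List ℝ → (ℝ → List ℝ) → ℕ
  size X row = sum (map (λ x → length (row x)) X)

  length-points : ∀ X row → length (points X row) ≡ size X row
  length-points []      row = refl
  length-points (x ∷ X) row = trans (length-++ (map (x ,_) (row x)))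
    (cong₂ ℕ._+_ (length-map (x ,_) (row x)) (length-points X row))

  ∈-points⁻ : ∀ X row {p} → p ∈ points X row →
              Σ ℝ λ x → Σ ℝ λ y → p ≡ (x , y) × x ∈ X × y ∈ row x
  ∈-points⁻ (x ∷ X) row p∈ with ∈-++⁻ (map (x ,_) (row x)) p∈
  ... | inj₁ p∈row with ∈-map⁻ (x ,_) p∈row
  ...   | y , y∈ , refl = x , y , refl , here refl , y∈
  ∈-points⁻ (x ∷ X) row p∈ | inj₂ p∈rest with ∈-points⁻ X row p∈rest
  ...   | x' , y , refl , x'∈ , y∈ = x' , y , refl , there x'∈ , y∈

  size-constant : ∀ X Y → size X (λ _ → Y) ≡ length X * length Y
  size-constant []      Y = refl
  size-constant (x ∷ X) Y = cong (length Y ℕ.+_) (size-constant X Y)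

  record Good (L : List (Fin r)) (X : List ℝ) (row : ℝ → List ℝ) : Set where
    field
      columns-distinct : Unique X
      rows-distinct    : ∀ {x} → x ∈ X → Unique (row x)
      inside           : ∀ {x y} → x ∈ X → y ∈ row x → x ∈ A × y ∈ B
      colours          : ∀ {x y} → x ∈ X → y ∈ row x → c x y ∈ L ⊎ Corner
      nested           : ∀ {x x' y} → x ∈ X → x' ∈ X → x < x' → y ∈ row x' → y ∈ row x

  grid : Unique A → Unique B → Good (allFin r) A (λ _ → B)
  grid A-distinct B-distinct = record
    { columns-distinct = A-distinct
    ; rows-distinct    = λ _ → B-distinct
    ; inside           = _,_
    ; colours          = λ {x} {y} _ _ → inj₁ (∈-allFin (c x y))
    ; nested           = λ _ _ _ y∈ → y∈
    }

  Label : Set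
  Label = ℝ × Fin r

  label : ℝ × ℝ → Label
  label (x , y) = x + y , c x y

  _≟ₗ_ : DecidableEquality Label
  _≟ₗ_ = ≡-dec _≟_ Fin._≟_

  open Pigeonhole _≟ₗ_ label using (fibre; fibreSize; pigeonhole)

  label-height : ∀ {x y s z} → label (x , y) ≡ (s , z) → y ≡ s - x
  label-height eq = solve-for _ _ _ (cong proj₁ eq)

  -- Column x carries a point of label (s , z); that point can only be (x , s - x).
  Carries : Label → (ℝ → List ℝ) → ℝ → Set
  Carries (s , z) row x = (s - x) ∈ row x × c x (s - x) ≡ z

  carries? : ∀ b row → Decidable (Carries b row)
  carries? (s , z) row x = ((s - x) ∈? row x) ×-dec (c x (s - x) Fin.≟ z)

  selected : Label → (ℝ → List ℝ) → List ℝ → List ℝ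
  selected b row = filter (carries? b row)

  column-fibre : ∀ b x row → Unique (row x) →
                 fibreSize b (map (x ,_) (row x)) ≤ length (selected b row (x ∷ []))
  column-fibre b@(_ , _) x row row-distinct = by-decision (carries? b row x)
    where
    column = map (x ,_) (row x)
    by-decision : Dec (Carries b row x) → fibreSize b column ≤ length (selected b row (x ∷ []))
    by-decision (yes carries) =
      ≤-trans (filter-at-most-one (λ p → label p ≟ₗ b) (Unique.map⁺ (cong proj₂) row-distinct) same-point)
              (≤-reflexive (sym (cong length (filter-accept (carries? b row) carries))))
      where
      same-point : ∀ {p q} → p ∈ column → q ∈ column → label p ≡ b → label q ≡ b → p ≡ q
      same-point p∈ q∈ p-label q-label with ∈-map⁻ (x ,_) p∈ | ∈-map⁻ (x ,_) q∈
      ... | y , _ , refl | y' , _ , refl = cong (x ,_) (trans (label-height p-label) (sym (label-height q-label)))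
    by-decision (no does-not-carry) =
      ≤-trans (≤-reflexive (cong length (filter-none (λ p → label p ≟ₗ b) (All.tabulate no-point)))) z≤n
      where
      no-point : ∀ {p} → p ∈ column → label p ≢ b
      no-point p∈ p-label with ∈-map⁻ (x ,_) p∈
      ... | y , y∈ , refl = does-not-carry
        (subst (_∈ row x) (label-height p-label) y∈ ,
         trans (cong (c x) (sym (label-height p-label))) (cong proj₂ p-label))

  fibre≤selected : ∀ b X row → (∀ {x} → x ∈ X → Unique (row x)) →
                   fibreSize b (points X row) ≤ length (selected b row X)
  fibre≤selected b []      row _ = z≤n
  fibre≤selected b (x ∷ X) row rows-distinct = begin
    fibreSize b (map (x ,_) (row x) ++ points X row)
      ≡⟨ cong length (filter-++ (λ p → label p ≟ₗ b) (map (x ,_) (row x)) (points X row)) ⟩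
    length (fibre b (map (x ,_) (row x)) ++ fibre b (points X row))
      ≡⟨ length-++ (fibre b (map (x ,_) (row x))) ⟩
    fibreSize b (map (x ,_) (row x)) ℕ.+ fibreSize b (points X row)
      ≤⟨ +-mono-≤ (column-fibre b x row (rows-distinct (here refl))) (fibre≤selected b X row (rows-distinct ∘ there)) ⟩
    length (selected b row (x ∷ [])) ℕ.+ length (selected b row X)
      ≡⟨ length-++ (selected b row (x ∷ [])) ⟨
    length (selected b row (x ∷ []) ++ selected b row X)
      ≡⟨ cong length (filter-++ (carries? b row) (x ∷ []) X) ⟨
    length (selected b row (x ∷ X)) ∎
    where open ≤-Reasoning

  heights : ℝ → List ℝ → ℝ → List ℝ
  heights s X x = map (λ w → s - w) (above x X)

  ∈-heights⁻ : ∀ s X {x y} → y ∈ heights s X x → Σ ℝ λ w → w ∈ X × x < w × y ≡ s - w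
  ∈-heights⁻ s X {x} y∈ with ∈-map⁻ (λ w → s - w) y∈
  ... | w , w∈ , refl with ∈-filter⁻ (x <?_) w∈
  ...   | w∈X , x<w = w , w∈X , x<w , refl

  size-heights : ∀ s X → Unique X → size X (heights s X) ≡ length X C 2
  size-heights s X X-distinct =
    trans (cong sum (map-cong (λ x → length-map (λ w → s - w) (above x X)) X)) (pairsAbove-self X X-distinct)

  -- Two columns x < x' carrying the label (s , z), together with the point
  -- (x , s - x') of colour z, form the corner with d = x' - x.
  corner : ∀ {L X row s z x x'} → Good L X row → x ∈ X → x' ∈ X → x < x' →
           Carries (s , z) row x → Carries (s , z) row x' → c x (s - x') ≡ z → Corner
  corner {s = s} {z} {x} {x'} good x∈ x'∈ x<x' (sx∈ , sx-colour) (sx'∈ , sx'-colour) z-colour =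
    x , s - x' , x' - x , diff-pos x<x' ,
    proj₁ (inside x∈ sx∈) ,
    subst (_∈ A) (sym (+-diff x x')) (proj₁ (inside x'∈ sx'∈)) ,
    proj₂ (inside x'∈ sx'∈) ,
    subst (_∈ B) (sym (diff-telescope s x x')) (proj₂ (inside x∈ sx∈)) ,
    trans (cong (λ a → c a (s - x')) (+-diff x x')) (trans sx'-colour (sym z-colour)) ,
    trans (cong (c x) (diff-telescope s x x')) (trans sx-colour (sym z-colour))
    where open Good good

  _without_ : List (Fin r) → Fin r → List (Fin r)
  L without z = filter (λ w → ¬? (w Fin.≟ z)) L

  length-without : ∀ {z L} → z ∈ L → suc (length (L without z)) ≤ length L
  length-without {z} {L} z∈ = filter-notAll (λ w → ¬? (w Fin.≟ z)) L (Any.map (λ z≡w w≢z → w≢z (sym z≡w)) z∈)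

  step : ∀ {L X row} s z → Good L X row →
         Good (L without z) (selected (s , z) row X) (heights s (selected (s , z) row X))
  step {L} {X} {row} s z good = record
    { columns-distinct = X'-distinct
    ; rows-distinct    = λ _ → Unique.map⁺ (diff-injective s _ _) (Unique.filter⁺ (_ <?_) X'-distinct)
    ; inside           = inside'
    ; colours          = colours'
    ; nested           = nested'
    }
    where
    open Good good
    X' = selected (s , z) row X
    X'-distinct : Unique X'
    X'-distinct = Unique.filter⁺ (carries? (s , z) row) columns-distinct
    from-X' : ∀ {x} → x ∈ X' → x ∈ X × Carries (s , z) row x
    from-X' = ∈-filter⁻ (carries? (s , z) row)

    inside' : ∀ {x y} → x ∈ X' → y ∈ heights s X' x → x ∈ A × y ∈ B
    inside' x∈ y∈ with ∈-heights⁻ s X' y∈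
    ... | w , w∈ , _ , refl =
      proj₁ (inside (proj₁ (from-X' x∈)) (proj₁ (proj₂ (from-X' x∈)))) ,
      proj₂ (inside (proj₁ (from-X' w∈)) (proj₁ (proj₂ (from-X' w∈))))

    colours' : ∀ {x y} → x ∈ X' → y ∈ heights s X' x → c x y ∈ L without z ⊎ Corner
    colours' {x} x∈ y∈ with ∈-heights⁻ s X' y∈
    ... | w , w∈ , x<w , refl with from-X' x∈ | from-X' w∈
    ...   | x∈X , x-carries | w∈X , w-carries with colours x∈X (nested x∈X w∈X x<w (proj₁ w-carries))
    ...     | inj₂ found = inj₂ found
    ...     | inj₁ in-L with c x (s - w) Fin.≟ z
    ...       | yes z-colour = inj₂ (corner good x∈X w∈X x<w x-carries w-carries z-colour)
    ...       | no other     = inj₁ (∈-filter⁺ (λ v → ¬? (v Fin.≟ z)) in-L other)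

    nested' : ∀ {x x' y} → x ∈ X' → x' ∈ X' → x < x' → y ∈ heights s X' x' → y ∈ heights s X' x
    nested' {x} x∈ x'∈ x<x' y∈ with ∈-heights⁻ s X' y∈
    ... | w , w∈ , x'<w , refl = ∈-map⁺ (λ v → s - v) (∈-filter⁺ (x <?_) w∈ (<-trans x<x' x'<w))

  some-point : ∀ ℓ {m} X row → 1 ≤ m → Dense ℓ m (size X row) → ∃ λ p → p ∈ points X row
  some-point ℓ X row m≥1 dense =
    some-element (points X row) (subst (1 ≤_) (sym (length-points X row)) (dense⇒nonempty {ℓ} m≥1 dense))

  labelled : ∀ {L X row p} → Good L X row → p ∈ points X row → label p ∈ cartesianProduct S L ⊎ Corner
  labelled {X = X} {row} good p∈ with ∈-points⁻ X row p∈
  ... | x , y , refl , x∈ , y∈ with Good.colours good x∈ y∈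
  ...   | inj₂ found = inj₂ found
  ...   | inj₁ in-L  = inj₁ (∈-cartesianProduct⁺ (A+B⊆S x y (proj₁ in-grid) (proj₂ in-grid)) in-L)
    where in-grid = Good.inside good x∈ y∈

  size≤selected : ∀ {ℓ m L X row} b → Good L X row → length S ≤ m → length L ≤ suc ℓ →
                  length (points X row) ≤ fibreSize b (points X row) * length (cartesianProduct S L) →
                  size X row ≤ length (selected b row X) * (m * suc ℓ)
  size≤selected {ℓ} {m} {L} {X} {row} b good |S|≤m |L|≤ℓ+1 popular = begin
    size X row                                                        ≡⟨ length-points X row ⟨
    length (points X row)                                             ≤⟨ popular ⟩
    fibreSize b (points X row) * length (cartesianProduct S L)
      ≤⟨ *-mono-≤ (fibre≤selected b X row (Good.rows-distinct good))
                  (≤-trans (≤-reflexive (length-cartesianProduct S L)) (*-mono-≤ |S|≤m |L|≤ℓ+1)) ⟩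
    length (selected b row X) * (m * suc ℓ)                           ∎
    where open ≤-Reasoning

  -- With no colour left, any point already witnesses one;
  -- otherwise pigeonhole selects a popular label (s , z) and `step` removes z.
  search : ∀ ℓ {m L X row} → length S ≤ m → 1 ≤ m → length L ≤ ℓ →
           Good L X row → Dense ℓ m (size X row) → Corner
  search zero {L = L} {X} {row} |S|≤m m≥1 |L|≤0 good dense with labelled good (proj₂ (some-point zero X row m≥1 dense))
  ... | inj₂ found  = found
  ... | inj₁ in-S×L = contradiction (proj₂ (∈-cartesianProduct⁻ S L in-S×L)) (no-element |L|≤0)
  search (suc ℓ) {m} {L} {X} {row} |S|≤m m≥1 |L|≤ℓ+1 good dense
    with first-failure (points X row) (labelled good)
  ... | inj₁ found = found
  ... | inj₂ all-labelled
    with pigeonhole (cartesianProduct S L) (points X row) (proj₂ (some-point (suc ℓ) X row m≥1 dense)) all-labelled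
  ... | (s , z) , sz∈ , popular =
    search ℓ |S|≤m m≥1 fewer-colours good'
      (subst (Dense ℓ m) (sym (size-heights s X' (Good.columns-distinct good'))) dense')
    where
    X' = selected (s , z) row X
    good' = step s z good
    fewer-colours : length (L without z) ≤ ℓ
    fewer-colours = ≤-pred (≤-trans (length-without (proj₂ (∈-cartesianProduct⁻ S L sz∈))) |L|≤ℓ+1)
    dense' : Dense ℓ m (length X' C 2)
    dense' = dense-step {ℓ} (length X') m≥1 dense (size≤selected (s , z) good |S|≤m |L|≤ℓ+1 popular)

  grid-corner : ∀ {n m} → Unique A → Unique B → length A ≡ n → length B ≡ n → length S ≤ m →
                K r ≤ n → m ^ (2 ^ suc r) ≤ n ^ suc (2 ^ suc r) → Corner
  grid-corner {n} {m} A-distinct B-distinct |A|≡n |B|≡n |S|≤m K≤n m-bound =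
    search r |S|≤m m≥1 (≤-reflexive (length-tabulate id)) (grid A-distinct B-distinct)
      (subst (Dense r m) (sym grid-size) (dense-initial r K≤n m-bound))
    where
    n≥1 : 1 ≤ n
    n≥1 = ≤-trans (K-pos r) K≤n
    a∈A = proj₂ (some-element A (subst (1 ≤_) (sym |A|≡n) n≥1))
    b∈B = proj₂ (some-element B (subst (1 ≤_) (sym |B|≡n) n≥1))
    m≥1 : 1 ≤ m
    m≥1 = ≤-trans (member⇒nonempty (A+B⊆S _ _ a∈A b∈B)) |S|≤m
    grid-size : size A (λ _ → B) ≡ n * n
    grid-size = trans (size-constant A B) (cong₂ _*_ |A|≡n |B|≡n)

theorem3 : (R : RealNumbers) → let open RealNumbers R in
    (r : ℕ) → 1 ≤ r →
    ∃ λ (n₀ : ℕ) →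
      (A B : List ℝ) → Unique A → Unique B →
      (n : ℕ) → length A ≡ n → length B ≡ n → n₀ ≤ n →
      -- |A+B| ≤ n^(1+δ) with δ = 1/2^(r+1), i.e. |A+B|^(2^(r+1)) ≤ n^(2^(r+1)+1)
      (m : ℕ) → SumsetSizeAtMost R A B m → m ^ (2 ^ suc r) ≤ n ^ suc (2 ^ suc r) →
      (c : ℝ → ℝ → Fin r) →
      Σ ℝ λ a → Σ ℝ λ b → Σ ℝ λ d →
        (0ℝ < d) × (a ∈ A) × ((a + d) ∈ A) × (b ∈ B) × ((b + d) ∈ B) ×
        (c (a + d) b ≡ c a b) × (c a (b + d) ≡ c a b)
theorem3 R r _ =
  Density.K r , λ A B A-distinct B-distinct n |A|≡n |B|≡n K≤n m (S , |S|≤m , A+B⊆S) m-bound c →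
    CornerSearch.grid-corner R A B S c A+B⊆S A-distinct B-distinct |A|≡n |B|≡n |S|≤m K≤n m-bound
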